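{- Let $(x_i)_{i=0}^\infty$ be an infinite sequence of names, $y$ a name, and $f$ a CCS relabelling with $f(x_iy)=x_{i+1}y$ for all $i$. Let $A$ be the CCS agent defined by $A:=x_0y.\mathbf 0+\tau.(A[f])$. Then there is no $\pi$-calculus process $Q$ with $A\stackrel{\bullet}{\sim}Q$; consequently there is no translation $\mathcal T$ from CCS to the $\pi$-calculus with $\mathcal T(P)\stackrel{\bullet}{\sim}P$ for all CCS processes $P$.
   Context: Here CCS is Milner's calculus (prefixing, sums, parallel composition, restriction, relabelling, agent identifiers with defining equations) whose visible actions are the input and output actions $xy$ and $\bar xy$ over a set of names (and their matched variants), so that $\bar{\cdot}$ sends $xy$ to $\bar xy$; a relabelling is a function $f$ on visible actions with $f(\bar a)=\overline{f(a)}$ and $f(\tau)=\tau$. The $\pi$-calculus is the standard one (Milner–Parrow–Walker) with its standard operational semantics. In both calculi reductions are $\tau$-transitions, and for a name $x$: $P\downarrow_x$ iff $P$ has a transition labelled by an input on $x$ ($xz$ or $x(z)$), and $P\downarrow_{\bar x}$ iff $P$ has a transition labelled by an output on $x$ ($\bar xz$ or $\bar x(z)$). Strong barbed bisimilarity $\stackrel{\bullet}{\sim}$, on the disjoint union of the two systems, is the largest symmetric relation $\mathcal R$ such that $P\mathcal RQ$ and $P\xrightarrow{\tau}P'$ imply $Q\xrightarrow{\tau}Q'$ with $P'\mathcal RQ'$, and $P\mathcal RQ$, $P\downarrow_b$ imply $Q\downarrow_b$. -}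

module Defs where

open import Data.Nat using (ℕ; zero; suc; _≡ᵇ_)
open import Data.Fin using (Fin; zero; suc)
open import Data.Bool using (Bool; true; false; if_then_else_; _∨_)
open import Data.Product using (Σ; Σ-syntax; _×_; _,_)
open import Relation.Binary.PropositionalEquality using (_≡_)
open import Relation.Nullary using (¬_)

-- Names are natural numbers (an infinite set of names), shared by
-- both calculi.

Name : Set
Name = ℕ

data VAct : Set where
  inp : Name → Name → VAct
  out : Name → Name → VAct

bar : VAct → VAct
bar (inp x y) = out x y
bar (out x y) = inp x y

data CLab : Set where
  τ   : CLab
  vis : VAct → CLab

record Relab : Set where
  field
    fn   : VAct → VAct
    comm : ∀ a → fn (bar a) ≡ bar (fn a)
open Relab public

relabL : Relab → CLab → CLab
relabL f τ = τ
relabL f (vis a) = vis (fn f a)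

-- CCS agents over a set K of agent identifiers.
-- Restriction P \ L takes a set L of visible actions (as a predicate).
data CCS (K : Set) : Set where
  nil  : CCS K
  pre  : CLab → CCS K → CCS K
  _⊕_  : CCS K → CCS K → CCS K
  _∥_  : CCS K → CCS K → CCS K
  res  : (VAct → Bool) → CCS K → CCS K
  rel  : CCS K → Relab → CCS K
  idt  : K → CCS K

-- labelled transitions, relative to defining equations  def : K → CCS K
-- (identifier A is defined by  A := def A)
data CStep {K : Set} (def : K → CCS K) : CCS K → CLab → CCS K → Set where
  c-pre  : ∀ {α P} → CStep def (pre α P) α P
  c-sumL : ∀ {P Q α P'} → CStep def P α P' → CStep def (P ⊕ Q) α P'
  c-sumR : ∀ {P Q α Q'} → CStep def Q α Q' → CStep def (P ⊕ Q) α Q'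
  c-parL : ∀ {P Q α P'} → CStep def P α P' → CStep def (P ∥ Q) α (P' ∥ Q)
  c-parR : ∀ {P Q α Q'} → CStep def Q α Q' → CStep def (P ∥ Q) α (P ∥ Q')
  c-com  : ∀ {P Q a P' Q'} → CStep def P (vis a) P' → CStep def Q (vis (bar a)) Q' →
           CStep def (P ∥ Q) τ (P' ∥ Q')
  c-resτ : ∀ {L P P'} → CStep def P τ P' → CStep def (res L P) τ (res L P')
  c-resV : ∀ {L P a P'} → CStep def P (vis a) P' → L a ≡ false → L (bar a) ≡ false →
           CStep def (res L P) (vis a) (res L P')
  c-rel  : ∀ {f P α P'} → CStep def P α P' → CStep def (rel P f) (relabL f α) (rel P' f)
  c-idt  : ∀ {A α P'} → CStep def (def A) α P' → CStep def (idt A) α P'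

-- π-calculus (Milner–Parrow–Walker), well-scoped de Bruijn for bound
-- names, concrete names (ℕ) for free names.  Early semantics.

data Nm (n : ℕ) : Set where
  fr : Name → Nm n
  bd : Fin n → Nm n

data Proc (n : ℕ) : Set where
  𝟎     : Proc n
  outP  : Nm n → Nm n → Proc n → Proc n
  inP   : Nm n → Proc (suc n) → Proc n
  tauP  : Proc n → Proc n
  _＋_  : Proc n → Proc n → Proc n
  _｜_  : Proc n → Proc n → Proc n
  ν     : Proc (suc n) → Proc n
  mat   : Nm n → Nm n → Proc n → Proc n
  rep   : Proc n → Proc n

wkN : ∀ {n} → Nm n → Nm (suc n)
wkN (fr a) = fr a
wkN (bd i) = bd (suc i)

liftR : ∀ {m n} → (Nm m → Nm n) → Nm (suc m) → Nm (suc n)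
liftR σ (fr a) = wkN (σ (fr a))
liftR σ (bd zero) = bd zero
liftR σ (bd (suc i)) = wkN (σ (bd i))

ren : ∀ {m n} → (Nm m → Nm n) → Proc m → Proc n
ren σ 𝟎 = 𝟎
ren σ (outP a b P) = outP (σ a) (σ b) (ren σ P)
ren σ (inP a P) = inP (σ a) (ren (liftR σ) P)
ren σ (tauP P) = tauP (ren σ P)
ren σ (P ＋ Q) = ren σ P ＋ ren σ Q
ren σ (P ｜ Q) = ren σ P ｜ ren σ Q
ren σ (ν P) = ν (ren (liftR σ) P)
ren σ (mat a b P) = mat (σ a) (σ b) (ren σ P)
ren σ (rep P) = rep (ren σ P)

openσ : ∀ {n} → Name → Nm (suc n) → Nm n
openσ z (fr a) = fr a
openσ z (bd zero) = fr z
openσ z (bd (suc i)) = bd i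

openP : ∀ {n} → Name → Proc (suc n) → Proc n
openP z = ren (openσ z)

closeσ : ∀ {n} → Name → Nm n → Nm (suc n)
closeσ z (fr a) = if a ≡ᵇ z then bd zero else fr a
closeσ z (bd i) = bd (suc i)

closeP : ∀ {n} → Name → Proc n → Proc (suc n)
closeP z = ren (closeσ z)

occN : ∀ {n} → Name → Nm n → Bool
occN z (fr a) = a ≡ᵇ z
occN z (bd i) = false

occ : ∀ {n} → Name → Proc n → Bool
occ z 𝟎 = false
occ z (outP a b P) = occN z a ∨ occN z b ∨ occ z P
occ z (inP a P) = occN z a ∨ occ z P
occ z (tauP P) = occ z P
occ z (P ＋ Q) = occ z P ∨ occ z Q
occ z (P ｜ Q) = occ z P ∨ occ z Q
occ z (ν P) = occ z P
occ z (mat a b P) = occN z a ∨ occN z b ∨ occ z P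
occ z (rep P) = occ z P

_#_ : ∀ {n} → Name → Proc n → Set
z # P = occ z P ≡ false

-- π labels: τ, (early) input x z, free output x̄ z, bound output x̄(z)
data PLab : Set where
  τ    : PLab
  inp  : Name → Name → PLab
  out  : Name → Name → PLab
  bout : Name → Name → PLab

data _∉L_ (z : Name) : PLab → Set where
  nτ    : z ∉L τ
  ninp  : ∀ {a b} → ¬ (a ≡ z) → ¬ (b ≡ z) → z ∉L inp a b
  nout  : ∀ {a b} → ¬ (a ≡ z) → ¬ (b ≡ z) → z ∉L out a b
  nbout : ∀ {a b} → ¬ (a ≡ z) → ¬ (b ≡ z) → z ∉L bout a b

data BnFresh (Q : Proc 0) : PLab → Set where
  bfτ    : BnFresh Q τ
  bfinp  : ∀ {a b} → BnFresh Q (inp a b)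
  bfout  : ∀ {a b} → BnFresh Q (out a b)
  bfbout : ∀ {a z} → z # Q → BnFresh Q (bout a z)

data PStep : Proc 0 → PLab → Proc 0 → Set where
  p-out   : ∀ {a b P} → PStep (outP (fr a) (fr b) P) (out a b) P
  p-inp   : ∀ {a z P} → PStep (inP (fr a) P) (inp a z) (openP z P)
  p-tau   : ∀ {P} → PStep (tauP P) τ P
  p-sumL  : ∀ {P Q α P'} → PStep P α P' → PStep (P ＋ Q) α P'
  p-sumR  : ∀ {P Q α Q'} → PStep Q α Q' → PStep (P ＋ Q) α Q'
  p-mat   : ∀ {a P α P'} → PStep P α P' → PStep (mat (fr a) (fr a) P) α P'
  p-parL  : ∀ {P Q α P'} → PStep P α P' → BnFresh Q α → PStep (P ｜ Q) α (P' ｜ Q)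
  p-parR  : ∀ {P Q α Q'} → PStep Q α Q' → BnFresh P α → PStep (P ｜ Q) α (P ｜ Q')
  p-comL  : ∀ {P Q a b P' Q'} → PStep P (out a b) P' → PStep Q (inp a b) Q' →
            PStep (P ｜ Q) τ (P' ｜ Q')
  p-comR  : ∀ {P Q a b P' Q'} → PStep P (inp a b) P' → PStep Q (out a b) Q' →
            PStep (P ｜ Q) τ (P' ｜ Q')
  p-closeL : ∀ {P Q a z P' Q'} → PStep P (bout a z) P' → PStep Q (inp a z) Q' → z # Q →
             PStep (P ｜ Q) τ (ν (closeP z (P' ｜ Q')))
  p-closeR : ∀ {P Q a z P' Q'} → PStep P (inp a z) P' → PStep Q (bout a z) Q' → z # P →
             PStep (P ｜ Q) τ (ν (closeP z (P' ｜ Q')))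
  p-res   : ∀ {P z α P'} → z # ν P → z ∉L α → PStep (openP z P) α P' →
            PStep (ν P) α (ν (closeP z P'))
  p-open  : ∀ {P z a P'} → z # ν P → ¬ (a ≡ z) → PStep (openP z P) (out a z) P' →
            PStep (ν P) (bout a z) P'
  p-rep   : ∀ {P α P'} → PStep (P ｜ rep P) α P' → PStep (rep P) α P'

data Sys (K : Set) : Set where
  ccs : CCS K → Sys K
  pi  : Proc 0 → Sys K

data Barb : Set where
  ib : Name → Barb
  ob : Name → Barb

module Semantics {K : Set} (def : K → CCS K) where

  data _⟶_ : Sys K → Sys K → Set where
    red-ccs : ∀ {P P'} → CStep def P τ P' → ccs P ⟶ ccs P'
    red-pi  : ∀ {P P'} → PStep P τ P' → pi P ⟶ pi P'

  data _↓_ : Sys K → Barb → Set where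
    ccs-in  : ∀ {P x z P'} → CStep def P (vis (inp x z)) P' → ccs P ↓ ib x
    ccs-out : ∀ {P x z P'} → CStep def P (vis (out x z)) P' → ccs P ↓ ob x
    pi-in   : ∀ {P x z P'} → PStep P (inp x z) P' → pi P ↓ ib x
    pi-out  : ∀ {P x z P'} → PStep P (out x z) P' → pi P ↓ ob x
    pi-bout : ∀ {P x z P'} → PStep P (bout x z) P' → pi P ↓ ob x

  record IsStrongBarbedBisim (R : Sys K → Sys K → Set) : Set where
    field
      symm : ∀ {P Q} → R P Q → R Q P
      step : ∀ {P Q P'} → R P Q → P ⟶ P' → Σ[ Q' ∈ Sys K ] (Q ⟶ Q' × R P' Q')
      barb : ∀ {P Q b} → R P Q → P ↓ b → Q ↓ b

  -- strong barbed bisimilarity: the union (= largest) of all symmetric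
  -- strong barbed bisimulations
  _∼•_ : Sys K → Sys K → Set₁
  P ∼• Q = Σ[ R ∈ (Sys K → Sys K → Set) ] (IsStrongBarbedBisim R × R P Q)

module Submission where

-- A π-process never acquires free names by reducing: a τ-step uses only names the
-- process already has, and names created by restriction stay bound. So every barb
-- of every reduct of Q is on one of the finitely many free names of Q. A strong
-- barbed bisimulation transfers barbs of reducts, but the reducts A[f]ⁿ of A carry
-- the pairwise distinct input barbs xₙ.

open import Defs
open import Data.Nat using (ℕ; zero; suc; _<_; _⊔_; _≡ᵇ_)
open import Data.Nat.Properties using (≡ᵇ⇒≡; ≡⇒≡ᵇ; n<1+n; m<n⇒m<n⊔o; m<n⇒m<o⊔n)
open import Data.Fin using (zero; suc; toℕ; fromℕ<)
open import Data.Fin.Properties using (pigeonhole; fromℕ<-injective; toℕ-injective; <-irrefl)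
open import Data.Bool using (T; true; false; _∨_)
open import Data.Bool.Properties using (T-∨)
open import Data.Sum using (_⊎_; inj₁; inj₂; [_,_]′; map; map₁; swap)
open import Data.Empty using (⊥; ⊥-elim)
open import Data.Unit using (⊤; tt)
open import Data.Product using (Σ-syntax; ∃-syntax; _×_; _,_)
open import Function using (_∘_; id)
open import Function.Bundles using (Equivalence)
open import Function.Definitions using (Injective)
open import Relation.Binary.PropositionalEquality using (_≡_; _≢_; refl; sym; trans; subst)
open import Relation.Binary.Construct.Closure.ReflexiveTransitive using (Star; ε; _◅_; _◅◅_)
open import Relation.Nullary using (¬_)

open Equivalence using (to; from)

private
  ∨-introˡ : ∀ {a b} → T a → T (a ∨ b)
  ∨-introˡ h = from T-∨ (inj₁ h)

  ∨-introʳ : ∀ {a b} → T b → T (a ∨ b)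
  ∨-introʳ h = from T-∨ (inj₂ h)

  ∨-cases : ∀ {a b} → T (a ∨ b) → T a ⊎ T b
  ∨-cases = to T-∨

  ∨-idem : ∀ {a} → T (a ∨ a) → T a
  ∨-idem = [ id , id ]′ ∘ ∨-cases

_∈fnₙ_ : ∀ {n} → Name → Nm n → Set
w ∈fnₙ a = T (occN w a)

_∈fn_ : ∀ {n} → Name → Proc n → Set
w ∈fn P = T (occ w P)

_⊆fn_ : ∀ {m n} → Proc m → Proc n → Set
P ⊆fn Q = ∀ {w} → w ∈fn P → w ∈fn Q

-- Bound indices are over-approximated: each one counts as mentioned.
Mentions : ∀ {m} → Proc m → Nm m → Set
Mentions P (fr v) = v ∈fn P
Mentions P (bd i) = ⊤

Mentions-mono : ∀ {m} {P Q : Proc m} (a : Nm m) → P ⊆fn Q → Mentions P a → Mentions Q a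
Mentions-mono (fr v) P⊆Q h = P⊆Q h
Mentions-mono (bd i) P⊆Q h = tt

wkN-∈fnₙ : ∀ {n w} (a : Nm n) → w ∈fnₙ wkN a → w ∈fnₙ a
wkN-∈fnₙ (fr v) h = h

Source : ∀ {m n} → (Nm m → Nm n) → Proc m → Name → Set
Source σ P w = ∃[ a ] (Mentions P a × w ∈fnₙ σ a)

source-here : ∀ {m n} (σ : Nm m → Nm n) {P : Proc m} {w} (a : Nm m) →
              (∀ {v} → v ∈fnₙ a → v ∈fn P) → w ∈fnₙ σ a → Source σ P w
source-here σ (fr v) a⊆P h = fr v , a⊆P (≡⇒≡ᵇ v v refl) , h
source-here σ (bd i) a⊆P h = bd i , tt , h

source-mono : ∀ {m n} (σ : Nm m → Nm n) {P Q : Proc m} {w} → P ⊆fn Q → Source σ P w → Source σ Q w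
source-mono σ P⊆Q (a , m , h) = a , Mentions-mono a P⊆Q m , h

source-lower : ∀ {m n} (σ : Nm m → Nm n) {P : Proc (suc m)} {Q : Proc m} {w} →
               P ⊆fn Q → Source (liftR σ) P w → Source σ Q w
source-lower σ P⊆Q (fr v , m , h) = fr v , P⊆Q m , wkN-∈fnₙ (σ (fr v)) h
source-lower σ P⊆Q (bd (suc i) , m , h) = bd i , tt , wkN-∈fnₙ (σ (bd i)) h

fn-ren : ∀ {m n} (σ : Nm m → Nm n) (P : Proc m) {w} → w ∈fn ren σ P → Source σ P w
fn-ren σ 𝟎 ()
fn-ren σ (outP a b P) h with ∨-cases {occN _ (σ a)} h
... | inj₁ h₁ = source-here σ a ∨-introˡ h₁
... | inj₂ h₂ with ∨-cases {occN _ (σ b)} h₂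
...   | inj₁ h₃ = source-here σ b (∨-introʳ {occN _ a} ∘ ∨-introˡ) h₃
...   | inj₂ h₄ = source-mono σ (∨-introʳ {occN _ a} ∘ ∨-introʳ {occN _ b}) (fn-ren σ P h₄)
fn-ren σ (inP a P) h with ∨-cases {occN _ (σ a)} h
... | inj₁ h₁ = source-here σ a ∨-introˡ h₁
... | inj₂ h₂ = source-lower σ (∨-introʳ {occN _ a}) (fn-ren (liftR σ) P h₂)
fn-ren σ (tauP P) h = source-mono σ id (fn-ren σ P h)
fn-ren σ (P ＋ Q) h =
  [ source-mono σ ∨-introˡ ∘ fn-ren σ P , source-mono σ (∨-introʳ {occ _ P}) ∘ fn-ren σ Q ]′
    (∨-cases {occ _ (ren σ P)} h)
fn-ren σ (P ｜ Q) h =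
  [ source-mono σ ∨-introˡ ∘ fn-ren σ P , source-mono σ (∨-introʳ {occ _ P}) ∘ fn-ren σ Q ]′
    (∨-cases {occ _ (ren σ P)} h)
fn-ren σ (ν P) h = source-lower σ id (fn-ren (liftR σ) P h)
fn-ren σ (mat a b P) h with ∨-cases {occN _ (σ a)} h
... | inj₁ h₁ = source-here σ a ∨-introˡ h₁
... | inj₂ h₂ with ∨-cases {occN _ (σ b)} h₂
...   | inj₁ h₃ = source-here σ b (∨-introʳ {occN _ a} ∘ ∨-introˡ) h₃
...   | inj₂ h₄ = source-mono σ (∨-introʳ {occN _ a} ∘ ∨-introʳ {occN _ b}) (fn-ren σ P h₄)
fn-ren σ (rep P) h = source-mono σ id (fn-ren σ P h)

fn-openP : ∀ z (P : Proc 1) {w} → w ∈fn openP z P → w ∈fn P ⊎ w ≡ z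
fn-openP z P h with fn-ren (openσ z) P h
... | fr v , v∈P , h′ with ≡ᵇ⇒≡ v _ h′
...   | refl = inj₁ v∈P
fn-openP z P h | bd zero , _ , h′ = inj₂ (sym (≡ᵇ⇒≡ z _ h′))

closeσ-∈fnₙ : ∀ {n} z v {w} → w ∈fnₙ closeσ {n} z (fr v) → v ≡ w × w ≢ z
closeσ-∈fnₙ z v {w} h with v ≡ᵇ z in v≢ᵇz
closeσ-∈fnₙ z v () | true
... | false = v≡w , λ w≡z → subst T v≢ᵇz (≡⇒≡ᵇ v z (trans v≡w w≡z))
  where
  v≡w : v ≡ w
  v≡w = ≡ᵇ⇒≡ v w h

fn-closeP : ∀ z (P : Proc 0) {w} → w ∈fn closeP z P → w ∈fn P × w ≢ z
fn-closeP z P h with fn-ren (closeσ z) P h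
... | fr v , v∈P , h′ with closeσ-∈fnₙ z v h′
...   | refl , w≢z = v∈P , w≢z

-- Names of a label that the acting process must already know, and names it may learn.
Old : PLab → Name → Set
Old τ          w = ⊥
Old (inp a b)  w = w ≡ a
Old (out a b)  w = w ≡ a ⊎ w ≡ b
Old (bout a b) w = w ≡ a

New : PLab → Name → Set
New τ          w = ⊥
New (inp a b)  w = w ≡ b
New (out a b)  w = ⊥
New (bout a b) w = w ≡ b

∉L-Old : ∀ {z α w} → z ∉L α → Old α w → w ≢ z
∉L-Old (ninp a≢z _) refl = a≢z
∉L-Old (nout a≢z _) (inj₁ refl) = a≢z
∉L-Old (nout _ b≢z) (inj₂ refl) = b≢z
∉L-Old (nbout a≢z _) refl = a≢z

old-fn : ∀ {P α P' w} → PStep P α P' → Old α w → w ∈fn P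
old-fn (p-out {a}) (inj₁ refl) = ∨-introˡ (≡⇒≡ᵇ a a refl)
old-fn (p-out {a} {b}) (inj₂ refl) = ∨-introʳ {a ≡ᵇ b} (∨-introˡ (≡⇒≡ᵇ b b refl))
old-fn (p-inp {a}) refl = ∨-introˡ (≡⇒≡ᵇ a a refl)
old-fn (p-sumL s) o = ∨-introˡ (old-fn s o)
old-fn (p-sumR {P} s) o = ∨-introʳ {occ _ P} (old-fn s o)
old-fn (p-mat {a} s) o = ∨-introʳ {a ≡ᵇ _} (∨-introʳ {a ≡ᵇ _} (old-fn s o))
old-fn (p-parL s _) o = ∨-introˡ (old-fn s o)
old-fn (p-parR {P} s _) o = ∨-introʳ {occ _ P} (old-fn s o)
old-fn (p-res {P} {z} _ z∉α s) o = [ id , ⊥-elim ∘ ∉L-Old z∉α o ]′ (fn-openP z P (old-fn s o))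
old-fn (p-open {P} {z} _ a≢z s) refl = [ id , ⊥-elim ∘ a≢z ]′ (fn-openP z P (old-fn s (inj₁ refl)))
old-fn (p-rep s) o = ∨-idem (old-fn s o)

fn-｜ : ∀ {X : Name → Set} (P Q P' Q' : Proc 0) →
        (∀ {w} → w ∈fn P' → w ∈fn P ⊎ X w) → (∀ {w} → w ∈fn Q' → w ∈fn Q ⊎ X w) →
        ∀ {w} → w ∈fn (P' ｜ Q') → w ∈fn (P ｜ Q) ⊎ X w
fn-｜ P Q P' Q' P'⊆ Q'⊆ h =
  [ map₁ ∨-introˡ ∘ P'⊆ , map₁ (∨-introʳ {occ _ P}) ∘ Q'⊆ ]′ (∨-cases {occ _ P'} h)

fn-｜-swap : ∀ {n} (P Q : Proc n) {w} → w ∈fn (P ｜ Q) → w ∈fn (Q ｜ P)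
fn-｜-swap P Q = from T-∨ ∘ swap ∘ ∨-cases {occ _ P}

fn-communication : ∀ {b} (P Q P' Q' : Proc 0) → b ∈fn P → P' ⊆fn P →
                   (∀ {w} → w ∈fn Q' → w ∈fn Q ⊎ w ≡ b) →
                   ∀ {w} → w ∈fn (P' ｜ Q') → w ∈fn (P ｜ Q)
fn-communication P Q P' Q' b∈P P'⊆P Q'⊆Q+b h =
  [ id , (λ { refl → ∨-introˡ b∈P }) ]′ (fn-｜ P Q P' Q' (inj₁ ∘ P'⊆P) Q'⊆Q+b h)

step-fn : ∀ {P α P'} → PStep P α P' → ∀ {w} → w ∈fn P' → w ∈fn P ⊎ New α w
step-fn (p-out {a} {b}) h = inj₁ (∨-introʳ {a ≡ᵇ _} (∨-introʳ {b ≡ᵇ _} h))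
step-fn (p-inp {a} {z} {P}) h = map₁ (∨-introʳ {a ≡ᵇ _}) (fn-openP z P h)
step-fn p-tau h = inj₁ h
step-fn (p-sumL s) h = map₁ ∨-introˡ (step-fn s h)
step-fn (p-sumR {P} s) h = map₁ (∨-introʳ {occ _ P}) (step-fn s h)
step-fn (p-mat {a} s) h = map₁ (∨-introʳ {a ≡ᵇ _} ∘ ∨-introʳ {a ≡ᵇ _}) (step-fn s h)
step-fn (p-parL {P} {Q} {P' = P'} s _) h = fn-｜ P Q P' Q (step-fn s) inj₁ h
step-fn (p-parR {P} {Q} {Q' = Q'} s _) h = fn-｜ P Q P Q' inj₁ (step-fn s) h
step-fn (p-comL {P} {Q} {P' = P'} {Q'} s t) h =
  inj₁ (fn-communication P Q P' Q' (old-fn s (inj₂ refl)) ([ id , ⊥-elim ]′ ∘ step-fn s) (step-fn t) h)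
step-fn (p-comR {P} {Q} {P' = P'} {Q'} s t) h =
  inj₁ (fn-｜-swap Q P
         (fn-communication Q P Q' P' (old-fn t (inj₂ refl)) ([ id , ⊥-elim ]′ ∘ step-fn t) (step-fn s)
           (fn-｜-swap P' Q' h)))
step-fn (p-closeL {P} {Q} {z = z} {P'} {Q'} s t _) h =
  let h′ , w≢z = fn-closeP z (P' ｜ Q') h
  in inj₁ ([ id , ⊥-elim ∘ w≢z ]′ (fn-｜ P Q P' Q' (step-fn s) (step-fn t) h′))
step-fn (p-closeR {P} {Q} {z = z} {P'} {Q'} s t _) h =
  let h′ , w≢z = fn-closeP z (P' ｜ Q') h
  in inj₁ ([ id , ⊥-elim ∘ w≢z ]′ (fn-｜ P Q P' Q' (step-fn s) (step-fn t) h′))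
step-fn (p-res {P} {z} {P' = P'} _ _ s) h =
  let h′ , w≢z = fn-closeP z P' h in map₁ ([ id , ⊥-elim ∘ w≢z ]′ ∘ fn-openP z P) (step-fn s h′)
step-fn (p-open {P} {z} _ _ s) h = [ fn-openP z P , ⊥-elim ]′ (step-fn s h)
step-fn (p-rep s) h = map₁ ∨-idem (step-fn s h)

fnBoundₙ : ∀ {n} → Nm n → ℕ
fnBoundₙ (fr a) = suc a
fnBoundₙ (bd i) = 0

fnBound : ∀ {n} → Proc n → ℕ
fnBound 𝟎            = 0
fnBound (outP a b P) = fnBoundₙ a ⊔ (fnBoundₙ b ⊔ fnBound P)
fnBound (inP a P)    = fnBoundₙ a ⊔ fnBound P
fnBound (tauP P)     = fnBound P
fnBound (P ＋ Q)     = fnBound P ⊔ fnBound Q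
fnBound (P ｜ Q)     = fnBound P ⊔ fnBound Q
fnBound (ν P)        = fnBound P
fnBound (mat a b P)  = fnBoundₙ a ⊔ (fnBoundₙ b ⊔ fnBound P)
fnBound (rep P)      = fnBound P

<-⊔ : ∀ {w} m n → w < m ⊎ w < n → w < m ⊔ n
<-⊔ m n = [ m<n⇒m<n⊔o n , m<n⇒m<o⊔n m ]′

∈fnₙ⇒<fnBoundₙ : ∀ {n w} (a : Nm n) → w ∈fnₙ a → w < fnBoundₙ a
∈fnₙ⇒<fnBoundₙ (fr a) h with ≡ᵇ⇒≡ a _ h
... | refl = n<1+n a

∈fn⇒<fnBound : ∀ {n w} (P : Proc n) → w ∈fn P → w < fnBound P
∈fn⇒<fnBound 𝟎 ()
∈fn⇒<fnBound (outP a b P) h =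
  <-⊔ _ _ (map (∈fnₙ⇒<fnBoundₙ a)
               (<-⊔ _ _ ∘ map (∈fnₙ⇒<fnBoundₙ b) (∈fn⇒<fnBound P) ∘ ∨-cases {occN _ b})
               (∨-cases {occN _ a} h))
∈fn⇒<fnBound (inP a P) h = <-⊔ _ _ (map (∈fnₙ⇒<fnBoundₙ a) (∈fn⇒<fnBound P) (∨-cases {occN _ a} h))
∈fn⇒<fnBound (tauP P) h = ∈fn⇒<fnBound P h
∈fn⇒<fnBound (P ＋ Q) h = <-⊔ _ _ (map (∈fn⇒<fnBound P) (∈fn⇒<fnBound Q) (∨-cases {occ _ P} h))
∈fn⇒<fnBound (P ｜ Q) h = <-⊔ _ _ (map (∈fn⇒<fnBound P) (∈fn⇒<fnBound Q) (∨-cases {occ _ P} h))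
∈fn⇒<fnBound (ν P) h = ∈fn⇒<fnBound P h
∈fn⇒<fnBound (mat a b P) h =
  <-⊔ _ _ (map (∈fnₙ⇒<fnBoundₙ a)
               (<-⊔ _ _ ∘ map (∈fnₙ⇒<fnBoundₙ b) (∈fn⇒<fnBound P) ∘ ∨-cases {occN _ b})
               (∨-cases {occN _ a} h))
∈fn⇒<fnBound (rep P) h = ∈fn⇒<fnBound P h

injective⇒unbounded : (x : ℕ → ℕ) → Injective _≡_ _≡_ x → ∀ N → ¬ (∀ n → x n < N)
injective⇒unbounded x x-inj N x<N with pigeonhole (n<1+n N) (λ i → fromℕ< (x<N (toℕ i)))
... | i , j , i<j , same =
  <-irrefl (toℕ-injective (x-inj (fromℕ<-injective _ _ (x<N (toℕ i)) (x<N (toℕ j)) same))) i<j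

subject : Barb → Name
subject (ib x) = x
subject (ob x) = x

module _ {K : Set} {def : K → CCS K} where
  open Semantics def

  barb-fn : ∀ {Q b} → pi Q ↓ b → subject b ∈fn Q
  barb-fn (pi-in s)   = old-fn s refl
  barb-fn (pi-out s)  = old-fn s (inj₁ refl)
  barb-fn (pi-bout s) = old-fn s refl

  π-reduct-barb-fn : ∀ {Q t b} → Star _⟶_ (pi Q) t → t ↓ b → subject b ∈fn Q
  π-reduct-barb-fn ε t↓b = barb-fn t↓b
  π-reduct-barb-fn (red-pi s ◅ ss) t↓b = [ id , ⊥-elim ]′ (step-fn s (π-reduct-barb-fn ss t↓b))

  bisim-reduct-barb : ∀ {R} → IsStrongBarbedBisim R → ∀ {s t s' b} →
                      R s t → Star _⟶_ s s' → s' ↓ b → ∃[ t' ] (Star _⟶_ t t' × t' ↓ b)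
  bisim-reduct-barb B r ε s↓b = _ , ε , IsStrongBarbedBisim.barb B r s↓b
  bisim-reduct-barb B r (s ◅ ss) s↓b =
    let t₁ , t⟶t₁ , r₁ = IsStrongBarbedBisim.step B r s
        t' , tt* , t'↓b = bisim-reduct-barb B r₁ ss s↓b
    in t' , t⟶t₁ ◅ tt* , t'↓b

  ∼•-sym : ∀ {s t} → s ∼• t → t ∼• s
  ∼•-sym (R , B , r) = R , B , IsStrongBarbedBisim.symm B r

  ∼•π⇒reduct-barb-fn : ∀ {s Q s' b} → s ∼• pi Q → Star _⟶_ s s' → s' ↓ b → subject b ∈fn Q
  ∼•π⇒reduct-barb-fn (R , B , r) ss s'↓b =
    let t' , tt* , t'↓b = bisim-reduct-barb B r ss s'↓b in π-reduct-barb-fn tt* t'↓b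

relabelⁿ : ∀ {K} → ℕ → Relab → CCS K → CCS K
relabelⁿ zero    f P = P
relabelⁿ (suc n) f P = rel (relabelⁿ n f P) f

module _ {K : Set} {def : K → CCS K} (f : Relab) where
  open Semantics def

  relabelⁿ-unfold : ∀ {P} → CStep def P τ (rel P f) →
                    ∀ n → CStep def (relabelⁿ n f P) τ (relabelⁿ (suc n) f P)
  relabelⁿ-unfold s zero    = s
  relabelⁿ-unfold s (suc n) = c-rel (relabelⁿ-unfold s n)

  relabelⁿ-reduces : ∀ {P} → CStep def P τ (rel P f) → ∀ n → Star _⟶_ (ccs P) (ccs (relabelⁿ n f P))
  relabelⁿ-reduces s zero    = ε
  relabelⁿ-reduces s (suc n) = relabelⁿ-reduces s n ◅◅ red-ccs (relabelⁿ-unfold s n) ◅ ε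

  relabelⁿ-input : ∀ {x : ℕ → Name} {y P P'} → (∀ i → fn f (inp (x i) y) ≡ inp (x (suc i)) y) →
                   CStep def P (vis (inp (x zero) y)) P' →
                   ∀ n → CStep def (relabelⁿ n f P) (vis (inp (x n) y)) (relabelⁿ n f P')
  relabelⁿ-input shift s zero    = s
  relabelⁿ-input {P = P} {P'} shift s (suc n) =
    subst (λ a → CStep def (relabelⁿ (suc n) f P) (vis a) (relabelⁿ (suc n) f P')) (shift n)
          (c-rel (relabelⁿ-input shift s n))

mainTheorem6 : (x : ℕ → Name) → Injective _≡_ _≡_ x → (y : Name) →
    (f : Relab) → (∀ i → fn f (inp (x i) y) ≡ inp (x (suc i)) y) →
    {K : Set} → (def : K → CCS K) → (A : K) →
    def A ≡ (pre (vis (inp (x zero) y)) nil ⊕ pre τ (rel (idt A) f)) →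
    let open Semantics def in
    (¬ (Σ[ Q ∈ Proc 0 ] (ccs (idt A) ∼• pi Q)))
    × (¬ (Σ[ T ∈ (CCS K → Proc 0) ] (∀ P → pi (T P) ∼• ccs P)))
mainTheorem6 x x-inj y f shift {K} def A A-def = no-π-equivalent , no-translation
  where
  open Semantics def

  A-τ : CStep def (idt A) τ (rel (idt A) f)
  A-τ = c-idt (subst (λ D → CStep def D τ (rel (idt A) f)) (sym A-def) (c-sumR c-pre))

  A-input : CStep def (idt A) (vis (inp (x zero) y)) nil
  A-input = c-idt (subst (λ D → CStep def D (vis (inp (x zero) y)) nil) (sym A-def) (c-sumL c-pre))

  no-π-equivalent : ¬ (Σ[ Q ∈ Proc 0 ] (ccs (idt A) ∼• pi Q))
  no-π-equivalent (Q , A∼Q) = injective⇒unbounded x x-inj (fnBound Q) λ n →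
    ∈fn⇒<fnBound Q
      (∼•π⇒reduct-barb-fn A∼Q (relabelⁿ-reduces f A-τ n) (ccs-in (relabelⁿ-input f shift A-input n)))

  no-translation : ¬ (Σ[ T ∈ (CCS K → Proc 0) ] (∀ P → pi (T P) ∼• ccs P))
  no-translation (T , T∼) = no-π-equivalent (T (idt A) , ∼•-sym (T∼ (idt A)))
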